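{- Let $(s_k)_{k\ge1}$ be a sequence of positive integers and let $i<j$ be positive integers. Write $\alpha_i=\alpha^{(s_k)}_i$, $\alpha_j=\alpha^{(s_k)}_j$, and $L=|\alpha_i|$. Then $\alpha_j$ is a concatenation $\beta_1\beta_2\cdots\beta_m$ of consecutive blocks of length $L$, each block $\beta_t$ being equal to $\alpha_i$ or to $\overline{\alpha}_i$, and the only occurrences of $\alpha_i$ as a factor of $\alpha_j$ are: (i) the blocks $\beta_t$ with $\beta_t=\alpha_i$; and (ii) the middle $L$ letters (i.e. the factor of length $L$ starting at position $L/2+1$) of $\beta_t\beta_{t+1}$ whenever $\beta_t=\beta_{t+1}=\overline{\alpha}_i$. Analogously, the only occurrences of $\overline{\alpha}_i$ as a factor of $\alpha_j$ are the blocks $\beta_t=\overline{\alpha}_i$ and the middle $L$ letters of $\beta_t\beta_{t+1}$ whenever $\beta_t=\beta_{t+1}=\alpha_i$.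
   Context: For a binary word $\gamma=\gamma_1\cdots\gamma_n$, its complement is $\overline{\gamma}=(1-\gamma_1)\cdots(1-\gamma_n)$. A factor of a word is a contiguous subword. Given a sequence $(s_k)_{k\ge1}$ of positive integers, define binary words $\alpha^{(s_k)}_1=01$ and, for $i\ge1$, $\alpha^{(s_k)}_{i+1}=(\alpha^{(s_k)}_i)^{s_i}(\overline{\alpha}^{(s_k)}_i)^{s_i}$; note $|\alpha^{(s_k)}_i|=2^is_1\cdots s_{i-1}$. -}

module Defs where

open import Data.Bool using (Bool; true; false; not)
open import Data.Nat using (ℕ; zero; suc; _+_; _*_)
open import Data.List using (List; []; _∷_; _++_; map; length)
open import Data.Product using (Σ; ∃; _×_; _,_)
open import Relation.Binary.PropositionalEquality using (_≡_)

-- Binary words are lists of booleans (false = 0, true = 1).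
Word : Set
Word = List Bool

compl : Word → Word
compl = map not

pow : Word → ℕ → Word
pow u zero    = []
pow u (suc n) = u ++ pow u n

-- α^{(s_k)}_i for i ≥ 1.  The sequence s is indexed from 1 (s 0 is unused).
-- α_1 = 01, α_{i+1} = α_i^{s_i} (compl α_i)^{s_i}.
-- α 0 is junk (the empty word) and never used in the statement (i ≥ 1).
α : (ℕ → ℕ) → ℕ → Word
α s zero          = []
α s (suc zero)    = false ∷ true ∷ []
α s (suc (suc i)) = pow (α s (suc i)) (s (suc i)) ++ pow (compl (α s (suc i))) (s (suc i))

-- u occurs as a factor of w starting at (0-indexed) position p
OccursAt : Word → Word → ℕ → Set
OccursAt u w p = Σ Word λ x → Σ Word λ y → (w ≡ x ++ u ++ y) × (length x ≡ p)

{-# OPTIONS --safe #-}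
-- Write α_{i+1} = H ++ compl H, with H = 0 for i = 0 and H = α_i^{s_i} otherwise.  Then α_{i+2}
-- and its complement are the images of the bit words 0^s 1^s and 1^s 0^s under the coding
-- b ↦ α_{i+1}, compl α_{i+1}, so every α_j with j > i is the image of a bit word.  All rests on
-- a synchronisation property of H: if the letter coding c occurs inside the image of two
-- consecutive bits b b′ but not at a letter boundary, then b = b′ = ¬c and the occurrence starts
-- in the middle of b.  It follows that an occurrence of a letter in the image of any bit word is
-- aligned with a bit c or centred on a factor ¬c ¬c.  Synchronisation holds for H = 0 by
-- inspection and passes from H to α_{i+1}^s: the letters of the image of c^s (¬c)^s occur in the
-- image of b^s (¬b)^s b′^s (¬b′)^s at offsets that are all aligned or all centred (they differ by
-- multiples of |α_{i+1}|); a centred window is impossible across the boundary c ¬c, and comparing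
-- bits in an aligned window forces b = b′ = ¬c and a shift by exactly s letters.

module Submission where

open import Defs
open import Data.Bool using (Bool; true; false; not)
open import Data.Bool.Properties using (not-involutive; not-¬)
open import Data.List using (List; []; _∷_; _++_; length; concat; map; replicate)
open import Data.List.Properties
  using (length-++; length-map; length-replicate; map-++; map-∘; map-cong; map-id; concat-++;
         ++-assoc; ++-identityʳ; ++-conicalˡ; ++-conicalʳ; ∷-injective; ∷-injectiveˡ)
open import Data.List.Relation.Unary.All using (All; universal)
open import Data.List.Relation.Unary.All.Properties using (map⁺)
open import Data.Nat using (ℕ; zero; suc; _+_; _*_; _∸_; _/_; _%_; _≤_; _<_; _≤?_; z≤n; s≤s; NonZero; >-nonZero)
open import Data.Nat.Properties
open import Data.Nat.DivMod using (m*n%n≡0; [m+kn]%n≡m%n; m<n⇒m%n≡m; m*n/n≡m)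
open import Data.Nat.Tactic.RingSolver using (solve-∀)
open import Data.Product using (Σ; _×_; _,_; proj₁; proj₂)
open import Data.Sum using (_⊎_; inj₁; inj₂)
open import Function.Base using (_∘_)
open import Function.Bundles using (_⇔_; mk⇔)
open import Function.Construct.Composition using (_⇔-∘_)
open import Function.Definitions using (Injective)
open import Relation.Binary.Definitions using (tri<; tri≈; tri>)
open import Relation.Binary.PropositionalEquality
open import Relation.Nullary using (yes; no; contradiction)

++-split : ∀ {A : Set} (xs ys us vs : List A) → xs ++ ys ≡ us ++ vs → length us ≤ length xs →
           Σ (List A) λ ms → (xs ≡ us ++ ms) × (vs ≡ ms ++ ys)
++-split xs       ys []       vs eq _         = xs , refl , sym eq
++-split (x ∷ xs) ys (u ∷ us) vs eq (s≤s us≤xs) with ∷-injective eq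
... | refl , eq′ with ++-split xs ys us vs eq′ us≤xs
...   | ms , refl , refl = ms , refl , refl

++-equal-lengthˡ : ∀ {A : Set} (xs ys us vs : List A) → xs ++ ys ≡ us ++ vs → length xs ≡ length us → xs ≡ us
++-equal-lengthˡ []       ys []       vs _  _   = refl
++-equal-lengthˡ (x ∷ xs) ys (u ∷ us) vs eq len with ∷-injective eq
... | refl , eq′ = cong (x ∷_) (++-equal-lengthˡ xs ys us vs eq′ (suc-injective len))

map≡++⁻ : ∀ {A B : Set} (f : A → B) xs ys zs → map f xs ≡ ys ++ zs →
          Σ (List A) λ xs₁ → Σ (List A) λ xs₂ → (xs ≡ xs₁ ++ xs₂) × (map f xs₁ ≡ ys) × (map f xs₂ ≡ zs)
map≡++⁻ f xs       []       zs eq = [] , xs , refl , refl , eq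
map≡++⁻ f (x ∷ xs) (y ∷ ys) zs eq with ∷-injective eq
... | refl , eq′ with map≡++⁻ f xs ys zs eq′
...   | xs₁ , xs₂ , refl , refl , refl = x ∷ xs₁ , xs₂ , refl , refl , refl

-- Reading xs as a word whose letters have length L: p starts a letter u, or lies at offset m
-- inside a factor v v.
Site : {A : Set} → ℕ → ℕ → A → A → List A → ℕ → Set
Site {A} L m u v xs p =
  (Σ (List A) λ pre → Σ (List A) λ post → (xs ≡ pre ++ u ∷ post) × (p ≡ length pre * L)) ⊎
  (Σ (List A) λ pre → Σ (List A) λ post → (xs ≡ pre ++ v ∷ v ∷ post) × (p ≡ length pre * L + m))

Site-map : ∀ {A B : Set} {f : A → B} → Injective _≡_ _≡_ f →
           ∀ L m u v xs p → Site L m u v xs p ⇔ Site L m (f u) (f v) (map f xs) p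
Site-map {f = f} f-inj L m u v xs p = mk⇔ to from
  where
  length-map-pre : ∀ pre → length pre * L ≡ length (map f pre) * L
  length-map-pre pre = cong (_* L) (sym (length-map f pre))

  to : Site L m u v xs p → Site L m (f u) (f v) (map f xs) p
  to (inj₁ (pre , post , refl , refl)) =
    inj₁ (map f pre , map f post , map-++ f pre _ , length-map-pre pre)
  to (inj₂ (pre , post , refl , refl)) =
    inj₂ (map f pre , map f post , map-++ f pre _ , cong (_+ m) (length-map-pre pre))

  from : Site L m (f u) (f v) (map f xs) p → Site L m u v xs p
  from (inj₁ (pre , post , eq , refl)) with map≡++⁻ f xs pre _ eq
  ... | xs₁ , u′ ∷ xs₂ , refl , refl , eq′ with ∷-injective eq′
  ...   | fu′≡fu , _ rewrite f-inj fu′≡fu = inj₁ (xs₁ , xs₂ , refl , sym (length-map-pre xs₁))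
  from (inj₂ (pre , post , eq , refl)) with map≡++⁻ f xs pre _ eq
  ... | xs₁ , v′ ∷ v″ ∷ xs₂ , refl , refl , eq′ with ∷-injective eq′
  ...   | fv′≡fv , eq″ with ∷-injective eq″
  ...     | fv″≡fv , _ rewrite f-inj fv′≡fv | f-inj fv″≡fv =
    inj₂ (xs₁ , xs₂ , refl , cong (_+ m) (sym (length-map-pre xs₁)))

-- Out-of-range lookups return false; every lookup below is in range.
_!_ : List Bool → ℕ → Bool
[]       ! _     = false
(b ∷ bs) ! zero  = b
(b ∷ bs) ! suc j = bs ! j

!-++ˡ : ∀ xs ys j → j < length xs → (xs ++ ys) ! j ≡ xs ! j
!-++ˡ (x ∷ xs) ys zero    _         = refl
!-++ˡ (x ∷ xs) ys (suc j) (s≤s j<n) = !-++ˡ xs ys j j<n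

!-++ʳ : ∀ xs ys j → (xs ++ ys) ! (length xs + j) ≡ ys ! j
!-++ʳ []       ys j = refl
!-++ʳ (x ∷ xs) ys j = !-++ʳ xs ys j

!-replicate : ∀ k d j → j < k → replicate k d ! j ≡ d
!-replicate (suc k) d zero    _         = refl
!-replicate (suc k) d (suc j) (s≤s j<k) = !-replicate k d j j<k

!-decompose : ∀ bs j → j < length bs →
  Σ (List Bool) λ pre → Σ (List Bool) λ post → (bs ≡ pre ++ bs ! j ∷ post) × (length pre ≡ j)
!-decompose (b ∷ bs) zero    _         = [] , bs , refl , refl
!-decompose (b ∷ bs) (suc j) (s≤s j<n) with !-decompose bs j j<n
... | pre , post , eq , refl = b ∷ pre , post , cong (b ∷_) eq , refl

!-middle : ∀ pre (c : Bool) post → (pre ++ c ∷ post) ! length pre ≡ c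
!-middle []        c post = refl
!-middle (_ ∷ pre) c post = !-middle pre c post

!-middle-suc : ∀ pre (c d : Bool) post → (pre ++ c ∷ d ∷ post) ! suc (length pre) ≡ d
!-middle-suc []        c d post = refl
!-middle-suc (_ ∷ pre) c d post = !-middle-suc pre c d post

++-regroup : ∀ {A : Set} (E P Q R : List A) →
             E ++ (P ++ Q) ++ (P ++ Q) ++ R ≡ (E ++ P) ++ (Q ++ P) ++ Q ++ R
++-regroup E P Q R = begin
  E ++ (P ++ Q) ++ (P ++ Q) ++ R    ≡⟨ cong (E ++_) (++-assoc P Q _) ⟩
  E ++ P ++ Q ++ (P ++ Q) ++ R      ≡⟨ cong (λ w → E ++ P ++ Q ++ w) (++-assoc P Q R) ⟩
  E ++ P ++ Q ++ P ++ Q ++ R        ≡⟨ cong (λ w → E ++ P ++ w) (++-assoc Q P (Q ++ R)) ⟨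
  E ++ P ++ (Q ++ P) ++ Q ++ R      ≡⟨ ++-assoc E P _ ⟨
  (E ++ P) ++ (Q ++ P) ++ Q ++ R    ∎
  where open ≡-Reasoning

half-double : ∀ n → (n + n) / 2 ≡ n
half-double n = trans (cong (_/ 2) (double n)) (m*n/n≡m n 2)
  where
  double : ∀ n → n + n ≡ n * 2
  double = solve-∀

runs : ℕ → Bool → List Bool
runs k d = replicate k d ++ replicate k (not d)

length-runs : ∀ k d → length (runs k d) ≡ k + k
length-runs k d = trans (length-++ (replicate k d)) (cong₂ _+_ (length-replicate k) (length-replicate k))

!-runs-low : ∀ k d j → j < k → runs k d ! j ≡ d
!-runs-low k d j j<k =
  trans (!-++ˡ (replicate k d) _ j (subst (j <_) (sym (length-replicate k)) j<k)) (!-replicate k d j j<k)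

!-runs-high : ∀ k d j → j < k → runs k d ! (k + j) ≡ not d
!-runs-high k d j j<k = begin
  runs k d ! (k + j)                             ≡⟨ cong (λ i → runs k d ! (i + j)) (sym (length-replicate k)) ⟩
  runs k d ! (length (replicate k d) + j)        ≡⟨ !-++ʳ (replicate k d) _ j ⟩
  replicate k (not d) ! j                        ≡⟨ !-replicate k (not d) j j<k ⟩
  not d                                          ∎
  where open ≡-Reasoning

!-runs²-low : ∀ k b b′ j → j < k → (runs k b ++ runs k b′) ! j ≡ b
!-runs²-low k b b′ j j<k =
  trans (!-++ˡ (runs k b) _ j (subst (j <_) (sym (length-runs k b)) (≤-trans j<k (m≤m+n k k))))
        (!-runs-low k b j j<k)

!-runs²-mid : ∀ k b b′ j → j < k → (runs k b ++ runs k b′) ! (k + j) ≡ not b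
!-runs²-mid k b b′ j j<k =
  trans (!-++ˡ (runs k b) _ (k + j) (subst (k + j <_) (sym (length-runs k b)) (+-monoʳ-< k j<k)))
        (!-runs-high k b j j<k)

!-runs²-high : ∀ k b b′ j → j < k → (runs k b ++ runs k b′) ! ((k + k) + j) ≡ b′
!-runs²-high k b b′ j j<k = begin
  (runs k b ++ runs k b′) ! ((k + k) + j)            ≡⟨ cong (λ i → (runs k b ++ runs k b′) ! (i + j)) (sym (length-runs k b)) ⟩
  (runs k b ++ runs k b′) ! (length (runs k b) + j)  ≡⟨ !-++ʳ (runs k b) _ j ⟩
  runs k b′ ! j                                      ≡⟨ !-runs-low k b′ j j<k ⟩
  b′                                                 ∎
  where open ≡-Reasoning

runs-window : ∀ k b b′ c t → 0 < k → 0 < t → t < k + k →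
  (∀ j → j < k + k → (runs k b ++ runs k b′) ! (t + j) ≡ runs k c ! j) →
  (b ≡ not c) × (b′ ≡ not c) × (t ≡ k)
runs-window k b b′ c t k>0 t>0 t<2k window with <-cmp t k
... | tri< t<k _ _ = contradiction (trans b≡c (sym ¬b≡c)) (not-¬ refl)
  where
  open ≡-Reasoning
  B = runs k b ++ runs k b′
  u = k ∸ t
  t+u≡k : t + u ≡ k
  t+u≡k = m+[n∸m]≡n (<⇒≤ t<k)
  u<k : u < k
  u<k = subst (u <_) t+u≡k (m<n+m u t>0)
  b≡c : b ≡ c
  b≡c = begin
    b               ≡⟨ sym (!-runs²-low k b b′ (t + 0) (subst (_< k) (sym (+-identityʳ t)) t<k)) ⟩
    B ! (t + 0)     ≡⟨ window 0 (<-≤-trans k>0 (m≤m+n k k)) ⟩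
    runs k c ! 0    ≡⟨ !-runs-low k c 0 k>0 ⟩
    c               ∎
  ¬b≡c : not b ≡ c
  ¬b≡c = begin
    not b           ≡⟨ sym (!-runs²-mid k b b′ 0 k>0) ⟩
    B ! (k + 0)     ≡⟨ cong (B !_) (trans (+-identityʳ k) (sym t+u≡k)) ⟩
    B ! (t + u)     ≡⟨ window u (≤-trans u<k (m≤m+n k k)) ⟩
    runs k c ! u    ≡⟨ !-runs-low k c u u<k ⟩
    c               ∎
... | tri≈ _ refl _ = trans (sym (not-involutive b)) (cong not ¬b≡c) , b′≡¬c , refl
  where
  open ≡-Reasoning
  B = runs k b ++ runs k b′
  ¬b≡c : not b ≡ c
  ¬b≡c = begin
    not b           ≡⟨ sym (!-runs²-mid k b b′ 0 k>0) ⟩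
    B ! (k + 0)     ≡⟨ window 0 (<-≤-trans k>0 (m≤m+n k k)) ⟩
    runs k c ! 0    ≡⟨ !-runs-low k c 0 k>0 ⟩
    c               ∎
  b′≡¬c : b′ ≡ not c
  b′≡¬c = begin
    b′                   ≡⟨ sym (!-runs²-high k b b′ 0 k>0) ⟩
    B ! ((k + k) + 0)    ≡⟨ cong (B !_) (+-identityʳ (k + k)) ⟩
    B ! (k + k)          ≡⟨ window k (m<m+n k k>0) ⟩
    runs k c ! k         ≡⟨ cong (runs k c !_) (sym (+-identityʳ k)) ⟩
    runs k c ! (k + 0)   ≡⟨ !-runs-high k c 0 k>0 ⟩
    not c                ∎
... | tri> _ _ k<t with m≤n⇒∃[o]m+o≡n (<⇒≤ k<t)
...   | u , refl = contradiction (trans (sym b′≡c) b′≡¬c) (not-¬ refl)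
  where
  open ≡-Reasoning
  B = runs k b ++ runs k b′
  u>0 : 0 < u
  u>0 = +-cancelˡ-< k 0 u (subst (_< k + u) (sym (+-identityʳ k)) k<t)
  u<k : u < k
  u<k = +-cancelˡ-< k u k t<2k
  w = k ∸ u
  u+w≡k : u + w ≡ k
  u+w≡k = m+[n∸m]≡n (<⇒≤ u<k)
  w<k : w < k
  w<k = subst (w <_) u+w≡k (m<n+m w u>0)
  swap : ∀ m n → (m + n) + m ≡ (m + m) + n
  swap = solve-∀
  b′≡c : b′ ≡ c
  b′≡c = begin
    b′                   ≡⟨ sym (!-runs²-high k b b′ 0 k>0) ⟩
    B ! ((k + k) + 0)    ≡⟨ cong (B !_) (trans (+-identityʳ (k + k)) (sym (trans (+-assoc k u w) (cong (k +_) u+w≡k)))) ⟩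
    B ! ((k + u) + w)    ≡⟨ window w (≤-trans w<k (m≤m+n k k)) ⟩
    runs k c ! w         ≡⟨ !-runs-low k c w w<k ⟩
    c                    ∎
  b′≡¬c : b′ ≡ not c
  b′≡¬c = begin
    b′                   ≡⟨ sym (!-runs²-high k b b′ u u<k) ⟩
    B ! ((k + k) + u)    ≡⟨ cong (B !_) (sym (swap k u)) ⟩
    B ! ((k + u) + k)    ≡⟨ window k (m<m+n k k>0) ⟩
    runs k c ! k         ≡⟨ cong (runs k c !_) (sym (+-identityʳ k)) ⟩
    runs k c ! (k + 0)   ≡⟨ !-runs-high k c 0 k>0 ⟩
    not c                ∎

-- Modulo the letter length h + h a centred offset leaves remainder h, an aligned one 0.
centred≢aligned : ∀ h t t′ → 0 < h → t * (h + h) + h ≢ t′ * (h + h)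
centred≢aligned h t t′ h>0 eq = <⇒≢ h>0 (sym h≡0)
  where
  open ≡-Reasoning
  instance
    h+h≢0 : NonZero (h + h)
    h+h≢0 = >-nonZero (<-≤-trans h>0 (m≤m+n h h))
  h≡0 : h ≡ 0
  h≡0 = begin
    h                               ≡⟨ sym (m<n⇒m%n≡m (m<m+n h h>0)) ⟩
    h % (h + h)                     ≡⟨ sym ([m+kn]%n≡m%n h t (h + h)) ⟩
    (h + t * (h + h)) % (h + h)     ≡⟨ cong (_% (h + h)) (trans (+-comm h _) eq) ⟩
    (t′ * (h + h)) % (h + h)        ≡⟨ m*n%n≡0 t′ (h + h) ⟩
    0                               ∎

compl-++ : ∀ u v → compl (u ++ v) ≡ compl u ++ compl v
compl-++ = map-++ not

compl-involutive : ∀ u → compl (compl u) ≡ u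
compl-involutive u = trans (sym (map-∘ u)) (trans (map-cong not-involutive u) (map-id u))

compl-pow : ∀ u k → compl (pow u k) ≡ pow (compl u) k
compl-pow u zero    = refl
compl-pow u (suc k) = trans (compl-++ u (pow u k)) (cong (compl u ++_) (compl-pow u k))

length-pow : ∀ u k → length (pow u k) ≡ k * length u
length-pow u zero    = refl
length-pow u (suc k) = trans (length-++ u) (cong (length u +_) (length-pow u k))

compl-≢ : ∀ u → 0 < length u → u ≢ compl u
compl-≢ (a ∷ u) _ eq = not-¬ refl (∷-injectiveˡ eq)

twin : Word → Word
twin H = H ++ compl H

length-twin : ∀ H → length (twin H) ≡ length H + length H
length-twin H = trans (length-++ H) (cong (length H +_) (length-map not H))

compl-twin : ∀ H → compl (twin H) ≡ compl H ++ H
compl-twin H = trans (compl-++ H (compl H)) (cong (compl H ++_) (compl-involutive H))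

module Coding (H : Word) where

  block : Bool → Word
  block false = twin H
  block true  = compl (twin H)

  encode : List Bool → Word
  encode bs = concat (map block bs)

  Synchronising : Set
  Synchronising = ∀ b b′ c (x y : Word) → 0 < length x → length x < length H + length H →
    block b ++ block b′ ≡ x ++ block c ++ y → (b ≡ not c) × (b′ ≡ not c) × (length x ≡ length H)

  length-block : ∀ b → length (block b) ≡ length H + length H
  length-block false = length-twin H
  length-block true  = trans (length-map not (twin H)) (length-twin H)

  compl-block : ∀ b → compl (block b) ≡ block (not b)
  compl-block false = refl
  compl-block true  = compl-involutive (twin H)

  block-rotation : ∀ c → Σ Word λ P → Σ Word λ Q →
    (block (not c) ≡ P ++ Q) × (block c ≡ Q ++ P) × (length P ≡ length H)
  block-rotation false = compl H , H , compl-twin H , refl , length-map not H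
  block-rotation true  = H , compl H , refl , compl-twin H , refl

  encode-++ : ∀ xs ys → encode (xs ++ ys) ≡ encode xs ++ encode ys
  encode-++ xs ys = trans (cong concat (map-++ block xs ys)) (sym (concat-++ (map block xs) _))

  length-encode : ∀ bs → length (encode bs) ≡ length bs * (length H + length H)
  length-encode []       = refl
  length-encode (b ∷ bs) = trans (length-++ (block b)) (cong₂ _+_ (length-block b) (length-encode bs))

  encode-pow : ∀ bs k → encode (pow bs k) ≡ pow (encode bs) k
  encode-pow bs zero    = refl
  encode-pow bs (suc k) = trans (encode-++ bs (pow bs k)) (cong (encode bs ++_) (encode-pow bs k))

  encode-replicate : ∀ k d → encode (replicate k d) ≡ pow (block d) k
  encode-replicate zero    d = refl
  encode-replicate (suc k) d = cong (block d ++_) (encode-replicate k d)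

  encode-compl : ∀ bs → encode (map not bs) ≡ compl (encode bs)
  encode-compl []       = refl
  encode-compl (b ∷ bs) =
    trans (cong₂ _++_ (sym (compl-block b)) (encode-compl bs)) (sym (compl-++ (block b) (encode bs)))

  AlignedAt : Bool → List Bool → ℕ → Set
  AlignedAt c bs p = Σ ℕ λ t → (bs ! t ≡ c) × (p ≡ t * (length H + length H))

  CentredAt : Bool → List Bool → ℕ → Set
  CentredAt c bs p = Σ ℕ λ t → (bs ! t ≡ not c) × (bs ! suc t ≡ not c) × (p ≡ t * (length H + length H) + length H)

  module _ (H≢[] : 0 < length H) where

    block≢[] : ∀ c → 0 < length (block c)
    block≢[] c = subst (0 <_) (sym (length-block c)) (<-≤-trans H≢[] (m≤m+n _ _))

    block-injective : Injective _≡_ _≡_ block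
    block-injective {false} {false} _  = refl
    block-injective {true}  {true}  _  = refl
    block-injective {false} {true}  eq = contradiction eq (compl-≢ (twin H) (block≢[] false))
    block-injective {true}  {false} eq = contradiction (sym eq) (compl-≢ (twin H) (block≢[] false))

    module _ (sync : Synchronising) where

      private
        h L : ℕ
        h = length H
        L = h + h

      site-cons : ∀ {c b bs p} → Site L h c (not c) bs p → Site L h c (not c) (b ∷ bs) (L + p)
      site-cons (inj₁ (pre , post , refl , refl)) = inj₁ (_ ∷ pre , post , refl , refl)
      site-cons (inj₂ (pre , post , refl , refl)) = inj₂ (_ ∷ pre , post , refl , sym (+-assoc L _ h))

      straddling⇒site : ∀ c b bs x y → block b ++ encode bs ≡ x ++ block c ++ y →
        0 < length x → length x < L → Site L h c (not c) (b ∷ bs) (length x)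
      straddling⇒site c b [] x y eq x>0 _ = contradiction (cong length eq) (<⇒≢ longer)
        where
        open ≤-Reasoning
        longer : length (block b ++ []) < length (x ++ block c ++ y)
        longer = begin-strict
          length (block b ++ [])               ≡⟨ cong length (++-identityʳ (block b)) ⟩
          length (block b)                     ≡⟨ trans (length-block b) (sym (length-block c)) ⟩
          length (block c)                     <⟨ m<n+m _ x>0 ⟩
          length x + length (block c)          ≤⟨ +-monoʳ-≤ (length x) (m≤m+n _ (length y)) ⟩
          length x + (length (block c) + length y) ≡⟨ cong (length x +_) (length-++ (block c)) ⟨
          length x + length (block c ++ y)     ≡⟨ length-++ x ⟨
          length (x ++ block c ++ y)           ∎
      straddling⇒site c b (b′ ∷ bs) x y eq x>0 x<L
        with ++-split (block b ++ block b′) (encode bs) (x ++ block c) y eq′ fits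
        where
        eq′ : (block b ++ block b′) ++ encode bs ≡ (x ++ block c) ++ y
        eq′ = trans (++-assoc (block b) _ _) (trans eq (sym (++-assoc x (block c) y)))
        fits : length (x ++ block c) ≤ length (block b ++ block b′)
        fits = subst₂ _≤_ (sym (trans (length-++ x) (cong (length x +_) (length-block c))))
                          (sym (trans (length-++ (block b)) (cong₂ _+_ (length-block b) (length-block b′))))
                          (+-monoˡ-≤ L (<⇒≤ x<L))
      ... | ms , two-blocks , _ with sync b b′ c x ms x>0 x<L (trans two-blocks (++-assoc x (block c) ms))
      ...   | refl , refl , x≡h = inj₂ ([] , bs , refl , x≡h)

      occurrence⇒site : ∀ c bs x y → encode bs ≡ x ++ block c ++ y → Site L h c (not c) bs (length x)
      occurrence⇒site c [] x y eq =
        contradiction (cong length (++-conicalˡ (block c) y (++-conicalʳ x _ (sym eq)))) (>⇒≢ (block≢[] c))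
      occurrence⇒site c (b ∷ bs) x y eq with L ≤? length x
      ... | yes L≤x with ++-split x (block c ++ y) (block b) (encode bs) (sym eq)
                                  (subst (_≤ length x) (sym (length-block b)) L≤x)
      ...   | x′ , refl , eq′ = subst (Site L h c (not c) (b ∷ bs)) (sym length-x)
                                      (site-cons (occurrence⇒site c bs x′ y eq′))
        where
        length-x : length (block b ++ x′) ≡ L + length x′
        length-x = trans (length-++ (block b)) (cong (_+ length x′) (length-block b))
      occurrence⇒site c (b ∷ bs) [] y eq | no _ =
        inj₁ ([] , bs , cong (_∷ bs) (block-injective block-b≡c) , refl)
        where
        block-b≡c : block b ≡ block c
        block-b≡c = ++-equal-lengthˡ _ _ _ _ eq (trans (length-block b) (sym (length-block c)))
      occurrence⇒site c (b ∷ bs) x@(_ ∷ _) y eq | no L≰x = straddling⇒site c b bs x y eq (s≤s z≤n) (≰⇒> L≰x)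

      site⇒occurrence : ∀ c bs p → Site L h c (not c) bs p → OccursAt (block c) (encode bs) p
      site⇒occurrence c _ _ (inj₁ (pre , post , refl , refl)) =
        encode pre , encode post , encode-++ pre (c ∷ post) , length-encode pre
      site⇒occurrence c _ _ (inj₂ (pre , post , refl , refl)) with block-rotation c
      ... | P , Q , ¬c≡PQ , c≡QP , length-P =
        encode pre ++ P , Q ++ encode post , split , trans (length-++ (encode pre)) (cong₂ _+_ (length-encode pre) length-P)
        where
        open ≡-Reasoning
        split : encode (pre ++ not c ∷ not c ∷ post) ≡ (encode pre ++ P) ++ block c ++ Q ++ encode post
        split = begin
          encode (pre ++ not c ∷ not c ∷ post)                         ≡⟨ encode-++ pre _ ⟩
          encode pre ++ block (not c) ++ block (not c) ++ encode post  ≡⟨ cong (λ w → encode pre ++ w ++ w ++ encode post) ¬c≡PQ ⟩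
          encode pre ++ (P ++ Q) ++ (P ++ Q) ++ encode post            ≡⟨ ++-regroup (encode pre) P Q (encode post) ⟩
          (encode pre ++ P) ++ (Q ++ P) ++ Q ++ encode post            ≡⟨ cong (λ w → (encode pre ++ P) ++ w ++ Q ++ encode post) c≡QP ⟨
          (encode pre ++ P) ++ block c ++ Q ++ encode post             ∎

      occurrence⇒position : ∀ c bs p → OccursAt (block c) (encode bs) p → AlignedAt c bs p ⊎ CentredAt c bs p
      occurrence⇒position c bs p (x , y , eq , refl) with occurrence⇒site c bs x y eq
      ... | inj₁ (pre , post , refl , x≡) = inj₁ (length pre , !-middle pre c post , x≡)
      ... | inj₂ (pre , post , refl , x≡) =
        inj₂ (length pre , !-middle pre (not c) (not c ∷ post) , !-middle-suc pre (not c) (not c) post , x≡)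

      occurrences : ∀ c bs p → OccursAt (block c) (encode bs) p ⇔
        Site (length (twin H)) (length (twin H) / 2) (block c) (block (not c)) (map block bs) p
      occurrences c bs p =
        subst₂ (λ L′ m′ → OccursAt (block c) (encode bs) p ⇔ Site L′ m′ (block c) (block (not c)) (map block bs) p)
               (sym (length-twin H)) (trans (sym (half-double h)) (cong (_/ 2) (sym (length-twin H))))
               (Site-map block-injective L h c (not c) bs p ⇔-∘ mk⇔ to (site⇒occurrence c bs p))
        where
        to : OccursAt (block c) (encode bs) p → Site L h c (not c) bs p
        to (x , y , eq , refl) = occurrence⇒site c bs x y eq

open Coding

block-pow-twin : ∀ H k d → block (pow (twin H) k) d ≡ encode H (runs k d)
block-pow-twin H k d = trans (blocks d) (sym (trans (encode-++ H (replicate k d) _)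
  (cong₂ _++_ (encode-replicate H k d) (encode-replicate H k (not d)))))
  where
  blocks : ∀ d → block (pow (twin H) k) d ≡ pow (block H d) k ++ pow (block H (not d)) k
  blocks false = cong (pow (twin H) k ++_) (compl-pow (twin H) k)
  blocks true  = trans (compl-twin (pow (twin H) k))
                       (cong (_++ pow (twin H) k) (compl-pow (twin H) k))

synchronising-step : ∀ H → 0 < length H → Synchronising H → ∀ k → 0 < k → Synchronising (pow (twin H) k)
synchronising-step H H≢[] sync k@(suc k′) k>0 b b′ c x y x>0 x<2|H′| eq =
  conclude (letter 0 (<-≤-trans k>0 (m≤m+n k k)))
  where
  H′ = pow (twin H) k
  h = length H
  L = h + h
  B = runs k b ++ runs k b′
  C = runs k c
  instance
    L≢0 : NonZero L
    L≢0 = >-nonZero (<-≤-trans H≢[] (m≤m+n h h))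

  length-H′ : length H′ ≡ k * L
  length-H′ = trans (length-pow (twin H) k) (cong (k *_) (length-twin H))

  encoded : encode H B ≡ x ++ encode H C ++ y
  encoded = begin
    encode H B                                    ≡⟨ encode-++ H (runs k b) (runs k b′) ⟩
    encode H (runs k b) ++ encode H (runs k b′)   ≡⟨ cong₂ _++_ (block-pow-twin H k b) (block-pow-twin H k b′) ⟨
    block H′ b ++ block H′ b′                     ≡⟨ eq ⟩
    x ++ block H′ c ++ y                          ≡⟨ cong (λ w → x ++ w ++ y) (block-pow-twin H k c) ⟩
    x ++ encode H C ++ y                          ∎
    where open ≡-Reasoning

  letter : ∀ j → j < k + k →
    AlignedAt H (C ! j) B (length x + j * L) ⊎ CentredAt H (C ! j) B (length x + j * L)
  letter j j<2k with !-decompose C j (subst (j <_) (sym (length-runs k c)) j<2k)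
  ... | pre , post , C≡ , refl =
    occurrence⇒position H H≢[] sync (C ! j) B _ (x ++ encode H pre , encode H post ++ y , split , length-prefix)
    where
    open ≡-Reasoning
    split : encode H B ≡ (x ++ encode H pre) ++ block H (C ! j) ++ encode H post ++ y
    split = begin
      encode H B                                                ≡⟨ encoded ⟩
      x ++ encode H C ++ y                                      ≡⟨ cong (λ w → x ++ encode H w ++ y) C≡ ⟩
      x ++ encode H (pre ++ C ! j ∷ post) ++ y                  ≡⟨ cong (λ w → x ++ w ++ y) (encode-++ H pre _) ⟩
      x ++ (encode H pre ++ block H (C ! j) ++ encode H post) ++ y
        ≡⟨ cong (x ++_) (++-assoc (encode H pre) _ y) ⟩
      x ++ encode H pre ++ (block H (C ! j) ++ encode H post) ++ y
        ≡⟨ cong (λ w → x ++ encode H pre ++ w) (++-assoc (block H (C ! j)) (encode H post) y) ⟩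
      x ++ encode H pre ++ block H (C ! j) ++ encode H post ++ y ≡⟨ ++-assoc x (encode H pre) _ ⟨
      (x ++ encode H pre) ++ block H (C ! j) ++ encode H post ++ y ∎
    length-prefix : length (x ++ encode H pre) ≡ length x + j * L
    length-prefix = trans (length-++ x) (cong (length x +_) (length-encode H pre))

  aligned-offset : ∀ t j → length x ≡ t * L → length x + j * L ≡ (t + j) * L
  aligned-offset t j x≡ = trans (cong (_+ j * L) x≡) (sym (*-distribʳ-+ L t j))

  centred-offset : ∀ t j → length x ≡ t * L + h → length x + j * L ≡ (t + j) * L + h
  centred-offset t j x≡ = trans (cong (_+ j * L) x≡) (regroup t j L h)
    where
    regroup : ∀ t j L h → (t * L + h) + j * L ≡ (t + j) * L + h
    regroup = solve-∀

  aligned-window : ∀ t → length x ≡ t * L → ∀ j → j < k + k → B ! (t + j) ≡ C ! j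
  aligned-window t x≡ j j<2k with letter j j<2k
  ... | inj₁ (t′ , B!t′ , p≡) =
    trans (cong (B !_) (*-cancelʳ-≡ (t + j) t′ L (trans (sym (aligned-offset t j x≡)) p≡))) B!t′
  ... | inj₂ (t′ , _ , _ , p≡) =
    contradiction (trans (sym p≡) (aligned-offset t j x≡)) (centred≢aligned h t′ (t + j) H≢[])

  centred-window : ∀ t → length x ≡ t * L + h → ∀ j → j < k + k →
    (B ! (t + j) ≡ not (C ! j)) × (B ! suc (t + j) ≡ not (C ! j))
  centred-window t x≡ j j<2k with letter j j<2k
  ... | inj₁ (t′ , _ , p≡) =
    contradiction (trans (sym (centred-offset t j x≡)) p≡) (centred≢aligned h (t + j) t′ H≢[])
  ... | inj₂ (t′ , B!t′ , B!suc-t′ , p≡) = subst (λ i → (B ! i ≡ _) × (B ! suc i ≡ _)) t′≡t+j (B!t′ , B!suc-t′)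
    where
    t′≡t+j : t′ ≡ t + j
    t′≡t+j = *-cancelʳ-≡ t′ (t + j) L (+-cancelʳ-≡ h _ _ (trans (sym p≡) (centred-offset t j x≡)))

  -- C has the factor c ¬c at positions k′, k; centred on it, B would be both ¬c and c at t + k.
  not-centred : ∀ t → length x ≢ t * L + h
  not-centred t x≡ = not-¬ refl (trans (sym from-k′) from-k)
    where
    open ≡-Reasoning
    from-k′ : B ! (t + k) ≡ not c
    from-k′ = begin
      B ! (t + k)         ≡⟨ cong (B !_) (+-suc t k′) ⟩
      B ! suc (t + k′)    ≡⟨ proj₂ (centred-window t x≡ k′ (≤-trans (n<1+n k′) (m≤m+n k k))) ⟩
      not (C ! k′)        ≡⟨ cong not (!-runs-low k c k′ (n<1+n k′)) ⟩
      not c               ∎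
    from-k : B ! (t + k) ≡ not (not c)
    from-k = begin
      B ! (t + k)         ≡⟨ proj₁ (centred-window t x≡ k (m<m+n k k>0)) ⟩
      not (C ! k)         ≡⟨ cong (λ i → not (C ! i)) (sym (+-identityʳ k)) ⟩
      not (C ! (k + 0))   ≡⟨ cong not (!-runs-high k c 0 k>0) ⟩
      not (not c)         ∎

  conclude : AlignedAt H (C ! 0) B (length x + 0 * L) ⊎ CentredAt H (C ! 0) B (length x + 0 * L) →
    (b ≡ not c) × (b′ ≡ not c) × (length x ≡ length H′)
  conclude (inj₂ (t , _ , _ , x≡)) = contradiction (trans (sym (+-identityʳ _)) x≡) (not-centred t)
  conclude (inj₁ (t , _ , x+0≡)) with runs-window k b b′ c t k>0 t>0 t<2k (aligned-window t x≡)
    where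
    x≡ : length x ≡ t * L
    x≡ = trans (sym (+-identityʳ _)) x+0≡
    t>0 : 0 < t
    t>0 = n≢0⇒n>0 (λ t≡0 → >⇒≢ x>0 (trans x≡ (cong (_* L) t≡0)))
    t<2k : t < k + k
    t<2k = *-cancelʳ-< L t (k + k) (begin-strict
      t * L                     ≡⟨ x≡ ⟨
      length x                  <⟨ x<2|H′| ⟩
      length H′ + length H′     ≡⟨ cong₂ _+_ length-H′ length-H′ ⟩
      k * L + k * L             ≡⟨ *-distribʳ-+ L k k ⟨
      (k + k) * L               ∎)
      where open ≤-Reasoning
  ... | b≡¬c , b′≡¬c , refl = b≡¬c , b′≡¬c , trans (trans (sym (+-identityʳ _)) x+0≡) (sym length-H′)

synchronising-0 : Synchronising (false ∷ [])
synchronising-0 b     b′    c     []              y () _ _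
synchronising-0 b     b′    c     (_ ∷ _ ∷ _)     y _ (s≤s (s≤s ())) _
synchronising-0 true  true  false (_ ∷ [])        y _ _ refl = refl , refl , refl
synchronising-0 false false true  (_ ∷ [])        y _ _ refl = refl , refl , refl
synchronising-0 false false false (_ ∷ [])        y _ _ ()
synchronising-0 false true  false (_ ∷ [])        y _ _ ()
synchronising-0 false true  true  (_ ∷ [])        y _ _ ()
synchronising-0 true  false false (_ ∷ [])        y _ _ ()
synchronising-0 true  false true  (_ ∷ [])        y _ _ ()
synchronising-0 true  true  true  (_ ∷ [])        y _ _ ()

seed : (ℕ → ℕ) → ℕ → Word
seed s zero    = false ∷ []
seed s (suc n) = pow (α s (suc n)) (s (suc n))

α≡twin-seed : ∀ s n → α s (suc n) ≡ twin (seed s n)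
α≡twin-seed s zero    = refl
α≡twin-seed s (suc n) = cong (pow (α s (suc n)) (s (suc n)) ++_) (sym (compl-pow (α s (suc n)) (s (suc n))))

seed≢[] : ∀ s → (∀ k → 1 ≤ k → 1 ≤ s k) → ∀ n → 0 < length (seed s n)
seed≢[] s s>0 zero    = s≤s z≤n
seed≢[] s s>0 (suc n) = subst (0 <_) (sym length-seed) (*-mono-≤ (s>0 (suc n) (s≤s z≤n)) α≢[])
  where
  length-seed : length (seed s (suc n)) ≡ s (suc n) * length (α s (suc n))
  length-seed = length-pow (α s (suc n)) (s (suc n))
  α≢[] : 0 < length (α s (suc n))
  α≢[] = subst (0 <_) (sym (trans (cong length (α≡twin-seed s n)) (length-twin (seed s n))))
               (<-≤-trans (seed≢[] s s>0 n) (m≤m+n _ _))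

seed-synchronising : ∀ s → (∀ k → 1 ≤ k → 1 ≤ s k) → ∀ n → Synchronising (seed s n)
seed-synchronising s s>0 zero    = synchronising-0
seed-synchronising s s>0 (suc n) =
  subst (λ A → Synchronising (pow A (s (suc n)))) (sym (α≡twin-seed s n))
        (synchronising-step (seed s n) (seed≢[] s s>0 n) (seed-synchronising s s>0 n) (s (suc n)) (s>0 (suc n) (s≤s z≤n)))

-- The spelling of α_{n+1+d} in the letters α_{n+1}, compl α_{n+1} (coded by false, true).
spelling : (ℕ → ℕ) → ℕ → ℕ → List Bool
spelling s n zero    = false ∷ []
spelling s n (suc d) = pow (spelling s n d) (s (suc (d + n))) ++ pow (map not (spelling s n d)) (s (suc (d + n)))

encode-spelling : ∀ s n d → encode (seed s n) (spelling s n d) ≡ α s (suc (d + n))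
encode-spelling s n zero    = trans (++-identityʳ (twin (seed s n))) (sym (α≡twin-seed s n))
encode-spelling s n (suc d) = begin
  encode H (pow w k ++ pow (map not w) k)                  ≡⟨ encode-++ H (pow w k) _ ⟩
  encode H (pow w k) ++ encode H (pow (map not w) k)       ≡⟨ cong₂ _++_ (encode-pow H w k) (encode-pow H (map not w) k) ⟩
  pow (encode H w) k ++ pow (encode H (map not w)) k       ≡⟨ cong (λ u → pow (encode H w) k ++ pow u k) (encode-compl H w) ⟩
  pow (encode H w) k ++ pow (compl (encode H w)) k         ≡⟨ cong (λ u → pow u k ++ pow (compl u) k) (encode-spelling s n d) ⟩
  α s (suc (suc d + n))                                    ∎
  where
  open ≡-Reasoning
  H = seed s n
  w = spelling s n d
  k = s (suc (d + n))

BlockDecomposition : Word → Word → Set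
BlockDecomposition u w = Σ (List Word) λ βs →
  (concat βs ≡ w) ×
  All (λ β → (β ≡ u) ⊎ (β ≡ compl u)) βs ×
  (∀ p → OccursAt u w p ⇔ Site (length u) (length u / 2) u (compl u) βs p) ×
  (∀ p → OccursAt (compl u) w p ⇔ Site (length u) (length u / 2) (compl u) u βs p)

encode-decomposition : ∀ H → 0 < length H → Synchronising H → ∀ bs → BlockDecomposition (twin H) (encode H bs)
encode-decomposition H H≢[] sync bs =
  map (block H) bs , refl , map⁺ (universal letter bs) , occurrences H H≢[] sync false bs , occurrences H H≢[] sync true bs
  where
  letter : ∀ b → (block H b ≡ twin H) ⊎ (block H b ≡ compl (twin H))
  letter false = inj₁ refl
  letter true  = inj₂ refl

proposition2p4 : (s : ℕ → ℕ) → (∀ k → 1 ≤ k → 1 ≤ s k) →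
    (i j : ℕ) → 1 ≤ i → i < j →
    Σ (List Word) λ βs →
      (concat βs ≡ α s j) ×
      All (λ β → (β ≡ α s i) ⊎ (β ≡ compl (α s i))) βs ×
      (∀ p → OccursAt (α s i) (α s j) p ⇔
        ((Σ (List Word) λ pre → Σ (List Word) λ post →
            (βs ≡ pre ++ α s i ∷ post) × (p ≡ length pre * length (α s i)))
         ⊎
         (Σ (List Word) λ pre → Σ (List Word) λ post →
            (βs ≡ pre ++ compl (α s i) ∷ compl (α s i) ∷ post) ×
            (p ≡ length pre * length (α s i) + length (α s i) / 2)))) ×
      (∀ p → OccursAt (compl (α s i)) (α s j) p ⇔
        ((Σ (List Word) λ pre → Σ (List Word) λ post →
            (βs ≡ pre ++ compl (α s i) ∷ post) × (p ≡ length pre * length (α s i)))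
         ⊎
         (Σ (List Word) λ pre → Σ (List Word) λ post →
            (βs ≡ pre ++ α s i ∷ α s i ∷ post) ×
            (p ≡ length pre * length (α s i) + length (α s i) / 2))))
proposition2p4 s s>0 (suc n) (suc m) _ (s≤s n<m) =
  subst₂ BlockDecomposition (sym (α≡twin-seed s n)) α-spelled
         (encode-decomposition (seed s n) (seed≢[] s s>0 n) (seed-synchronising s s>0 n) (spelling s n d))
  where
  d = m ∸ n
  α-spelled : encode (seed s n) (spelling s n d) ≡ α s (suc m)
  α-spelled = trans (encode-spelling s n d) (cong (α s ∘ suc) (m∸n+n≡m (<⇒≤ n<m)))
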